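{- Let $\mathfrak{v}$ be a language valuation over a set $X$ and $w_0, \dots, w_{n-1}$ words over $X$ ($n \ge 0$). For all terms $t$ and all $0 \le i \le j \le n$, if $\ell_i \cdots \ell_{j-1} \in \hat{\mathfrak{v}}^{\langle w_0, \dots, w_{n-1}\rangle}(t)$ then $w_i \cdots w_{j-1} \in \hat{\mathfrak{v}}(t)$.
   Context: Let $\mathbf{V}$ be a set of variables. Terms are generated by $t, s ::= x \mid \mathrm{I} \mid \bot \mid t \cdot s \mid t \cup s \mid t^{*} \mid x^{ - }$ ($x \in \mathbf{V}$). For a set $X$, a language valuation over $X$ is a map $\mathfrak{v}$ from variables to subsets of $X^{*}$ ($\mathrm{I}$ = empty word), extended to terms $\hat{\mathfrak{v}}$ by $\hat{\mathfrak{v}}(\mathrm{I}) = \{\mathrm{I}\}$, $\hat{\mathfrak{v}}(\bot) = \emptyset$, $\hat{\mathfrak{v}}(t\cdot s) = \{ab \mid a \in \hat{\mathfrak{v}}(t), b \in \hat{\mathfrak{v}}(s)\}$, $\hat{\mathfrak{v}}(t \cup s) = \hat{\mathfrak{v}}(t)\cup\hat{\mathfrak{v}}(s)$, $\hat{\mathfrak{v}}(t^{*}) = \hat{\mathfrak{v}}(t)^{*}$, $\hat{\mathfrak{v}}(x^{ - }) = X^{*} \setminus \mathfrak{v}(x)$. For such $\mathfrak{v}$ and words $w_0, \dots, w_{n-1}$ over $X$, with $\ell_0, \dots, \ell_{n-1}$ pairwise distinct letters, $\mathfrak{v}^{\langle w_0, \dots, w_{n-1}\rangle}$ is the language valuation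 over $\{\ell_0, \dots, \ell_{n-1}\}$ defined by $\mathfrak{v}^{\langle w_0, \dots, w_{n-1}\rangle}(x) = \{\ell_i \cdots \ell_{j-1} \mid 0 \le i \le j \le n,\ w_i \cdots w_{j-1} \in \mathfrak{v}(x)\}$ (when $i = j$ these are the empty words). -}

module Defs where

open import Data.Nat using (ℕ; zero; suc; _≤_; _+_; _∸_; s≤s; z≤n)
open import Data.Nat.Properties using (≤-trans; ≤-reflexive; +-suc; +-identityʳ; m≤m+n; m+[n∸m]≡n)
open import Function using (_⟨_⟩_)
open import Data.Fin using (Fin; toℕ; fromℕ<)
open import Data.List using (List; []; _∷_; _++_; concat; map)
open import Data.Product using (Σ; ∃; _×_; _,_)
open import Data.Sum using (_⊎_)
open import Relation.Nullary using (¬_)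
open import Relation.Binary.PropositionalEquality using (_≡_; sym; trans; cong)

data Term (V : Set) : Set where
  var  : V → Term V
  I    : Term V
  bot  : Term V
  _·_  : Term V → Term V → Term V
  _∪_  : Term V → Term V → Term V
  _⋆   : Term V → Term V
  _⁻   : V → Term V

Language : Set → Set₁
Language X = List X → Set

data Star {X : Set} (L : Language X) : Language X where
  star-nil  : Star L []
  star-cons : ∀ {a b} → L a → Star L b → Star L (a ++ b)

Valuation : Set → Set → Set₁
Valuation V X = V → Language X

⟦_⟧ : {V X : Set} → Term V → Valuation V X → Language X
⟦ var x ⟧ v w = v x w
⟦ I ⟧ v w = w ≡ []
⟦ bot ⟧ v w = Data.Empty.⊥
  where import Data.Empty
⟦ t · s ⟧ v w = Σ _ λ a → Σ _ λ b → (w ≡ a ++ b) × ⟦ t ⟧ v a × ⟦ s ⟧ v b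
⟦ t ∪ s ⟧ v w = ⟦ t ⟧ v w ⊎ ⟦ s ⟧ v w
⟦ t ⋆ ⟧ v w = Star (⟦ t ⟧ v) w
⟦ x ⁻ ⟧ v w = ¬ (v x w)

-- The letters ℓ_0,…,ℓ_{n-1} are the elements of Fin n (pairwise distinct).
bound : {n : ℕ} (i k : ℕ) → i + suc k ≤ n → suc i ≤ n
bound i k p = ≤-trans (s≤s (m≤m+n i k)) (≤-trans (≤-reflexive (sym (+-suc i k))) p)

lettersFrom : {n : ℕ} (i k : ℕ) → i + k ≤ n → List (Fin n)
lettersFrom i zero _ = []
lettersFrom {n} i (suc k) p =
  fromℕ< {i} (bound i k p)
  ∷ lettersFrom (suc i) k (≤-trans (≤-reflexive (sym (+-suc i k))) p)

letters : {n : ℕ} (i j : ℕ) → i ≤ j → j ≤ n → List (Fin n)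
letters i j i≤j j≤n = lettersFrom i (j ∸ i) (≤-trans (≤-reflexive (m+[n∸m]≡n i≤j)) j≤n)

wordsFrom : {X : Set} {n : ℕ} (w : Fin n → List X) (i k : ℕ) → i + k ≤ n → List X
wordsFrom w i zero _ = []
wordsFrom w i (suc k) p =
  w (fromℕ< {i} (bound i k p))
  ++ wordsFrom w (suc i) k (≤-trans (≤-reflexive (sym (+-suc i k))) p)

segment : {X : Set} {n : ℕ} → (Fin n → List X) → (i j : ℕ) → i ≤ j → j ≤ n → List X
segment w i j i≤j j≤n = wordsFrom w i (j ∸ i) (≤-trans (≤-reflexive (m+[n∸m]≡n i≤j)) j≤n)

restrictVal : {V X : Set} {n : ℕ} → Valuation V X → (Fin n → List X) → Valuation V (Fin n)
restrictVal {n = n} v w x u =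
  Σ ℕ λ i → Σ ℕ λ j → Σ (i ≤ j) λ i≤j → Σ (j ≤ n) λ j≤n →
    (u ≡ letters i j i≤j j≤n) × v x (segment w i j i≤j j≤n)

{-# OPTIONS --safe #-}
-- For k > 0 the letter word ℓ_i ⋯ ℓ_{i+k-1} determines i and k, so every
-- factorisation a ++ b of it cuts at some index m, into ℓ_i ⋯ ℓ_{m-1} and
-- ℓ_m ⋯ ℓ_{i+k-1}; the segment w_i ⋯ w_{i+k-1} factorises at the same index.
-- Hence concatenation and star transfer from letter words to segments, and the
-- theorem follows by induction on t. The complement case needs the converse
-- for variables, which holds because on a letter word the restricted valuation
-- of a variable is exactly membership of the corresponding segment.
module Submission where

open import Defs
open import Data.Nat using (ℕ; _≤_; zero; suc; _+_; _∸_)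
open import Data.Nat.Properties using (≤-irrelevant; ≤-trans; ≤-reflexive; +-identityʳ; +-suc; m≤m+n; m+n∸m≡n)
open import Data.Fin using (Fin)
open import Data.List using (List; []; _∷_; _++_)
open import Data.List.Properties using (∷-injective; ++-assoc)
open import Data.Product using (_,_; proj₁; proj₂)
open import Data.Sum using (inj₁; inj₂)
open import Relation.Binary.PropositionalEquality
open ≡-Reasoning

module _ {X : Set} {n : ℕ} (w : Fin n → List X) where

  lettersFrom-cong : ∀ {i i′ k k′} (p : i + k ≤ n) (p′ : i′ + k′ ≤ n) →
                     i ≡ i′ → k ≡ k′ → lettersFrom i k p ≡ lettersFrom i′ k′ p′
  lettersFrom-cong {i} {k = k} p p′ refl refl = cong (lettersFrom i k) (≤-irrelevant p p′)

  wordsFrom-cong : ∀ {i i′ k k′} (p : i + k ≤ n) (p′ : i′ + k′ ≤ n) →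
                   i ≡ i′ → k ≡ k′ → wordsFrom w i k p ≡ wordsFrom w i′ k′ p′
  wordsFrom-cong {i} {k = k} p p′ refl refl = cong (wordsFrom w i k) (≤-irrelevant p p′)

  lettersFrom-≡⇒wordsFrom-≡ : ∀ i k i′ k′ (p : i + k ≤ n) (p′ : i′ + k′ ≤ n) →
                              lettersFrom i k p ≡ lettersFrom i′ k′ p′ →
                              wordsFrom w i k p ≡ wordsFrom w i′ k′ p′
  lettersFrom-≡⇒wordsFrom-≡ i zero    i′ zero     p p′ e = refl
  lettersFrom-≡⇒wordsFrom-≡ i (suc k) i′ (suc k′) p p′ e =
    cong₂ _++_ (cong w (proj₁ (∷-injective e)))
               (lettersFrom-≡⇒wordsFrom-≡ (suc i) k (suc i′) k′ _ _ (proj₂ (∷-injective e)))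

  wordsFrom-++ : ∀ i k₁ k₂ (p : i + (k₁ + k₂) ≤ n) (p₁ : i + k₁ ≤ n) (p₂ : i + k₁ + k₂ ≤ n) →
                 wordsFrom w i (k₁ + k₂) p ≡ wordsFrom w i k₁ p₁ ++ wordsFrom w (i + k₁) k₂ p₂
  wordsFrom-++ i zero     k₂ p p₁ p₂ = wordsFrom-cong p p₂ (sym (+-identityʳ i)) refl
  wordsFrom-++ i (suc k₁) k₂ p p₁ p₂ = begin
    w _ ++ wordsFrom w (suc i) (k₁ + k₂) _
      ≡⟨ cong (w _ ++_) (wordsFrom-++ (suc i) k₁ k₂ _ _ q) ⟩
    w _ ++ (wordsFrom w (suc i) k₁ _ ++ wordsFrom w (suc i + k₁) k₂ q)
      ≡⟨ cong (λ u → w _ ++ (wordsFrom w (suc i) k₁ _ ++ u)) (wordsFrom-cong q p₂ (sym (+-suc i k₁)) refl) ⟩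
    w _ ++ (wordsFrom w (suc i) k₁ _ ++ wordsFrom w (i + suc k₁) k₂ p₂)
      ≡⟨ ++-assoc (w _) _ _ ⟨
    (w _ ++ wordsFrom w (suc i) k₁ _) ++ wordsFrom w (i + suc k₁) k₂ p₂ ∎
    where q = subst (λ m → m + k₂ ≤ n) (+-suc i k₁) p₂

  record LettersSplit (i k : ℕ) (a b : List (Fin n)) : Set where
    constructor splitAt
    field
      k₁ k₂   : ℕ
      k₁+k₂≡k : k₁ + k₂ ≡ k
      p₁      : i + k₁ ≤ n
      p₂      : i + k₁ + k₂ ≤ n
      a≡      : a ≡ lettersFrom i k₁ p₁
      b≡      : b ≡ lettersFrom (i + k₁) k₂ p₂

  lettersFrom-split : ∀ i k (p : i + k ≤ n) (a b : List (Fin n)) →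
                      a ++ b ≡ lettersFrom i k p → LettersSplit i k a b
  lettersFrom-split i k p [] b e =
    splitAt 0 k refl p₁ p₂ refl (trans e (lettersFrom-cong p p₂ (sym (+-identityʳ i)) refl))
    where
    p₁ = ≤-trans (≤-reflexive (+-identityʳ i)) (≤-trans (m≤m+n i k) p)
    p₂ = subst (λ m → m + k ≤ n) (sym (+-identityʳ i)) p
  lettersFrom-split i (suc k) p (x ∷ a) b e
    with ∷-injective e
  ... | x≡ , a++b≡ with lettersFrom-split (suc i) k _ a b a++b≡
  ... | splitAt k₁ k₂ k₁+k₂≡k p₁ p₂ a≡ b≡ =
    splitAt (suc k₁) k₂ (cong suc k₁+k₂≡k) p₁′ p₂′
      (cong₂ _∷_ x≡ (trans a≡ (lettersFrom-cong _ _ refl refl)))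
      (trans b≡ (lettersFrom-cong _ _ (sym (+-suc i k₁)) refl))
    where
    p₁′ = subst (_≤ n) (sym (+-suc i k₁)) p₁
    p₂′ = subst (λ m → m + k₂ ≤ n) (sym (+-suc i k₁)) p₂

  Transfers : Language (Fin n) → Language X → Set
  Transfers L L′ = ∀ i k (p : i + k ≤ n) → L (lettersFrom i k p) → L′ (wordsFrom w i k p)

  Star-transfers : ∀ {L L′} → Transfers L L′ → Transfers (Star L) (Star L′)
  Star-transfers {L} {L′} L⇒L′ i k p u∈L⋆ = go u∈L⋆ i k p refl
    where
    go : ∀ {u} → Star L u → ∀ i k (p : i + k ≤ n) → u ≡ lettersFrom i k p →
         Star L′ (wordsFrom w i k p)
    go star-nil i zero p e = star-nil
    go (star-cons {a} {b} a∈L b∈L⋆) i k p e with lettersFrom-split i k p a b e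
    ... | splitAt k₁ k₂ refl p₁ p₂ a≡ b≡ =
      subst (Star L′) (sym (wordsFrom-++ i k₁ k₂ p p₁ p₂))
        (star-cons (L⇒L′ i k₁ p₁ (subst L a≡ a∈L)) (go b∈L⋆ (i + k₁) k₂ p₂ b≡))

  module _ {V : Set} (v : Valuation V X) where

    restrictVal⁻ : ∀ x → Transfers (restrictVal v w x) (v x)
    restrictVal⁻ x i k p (i′ , j′ , _ , _ , e , segment∈v) =
      subst (v x) (sym (lettersFrom-≡⇒wordsFrom-≡ i k i′ (j′ ∸ i′) p _ e)) segment∈v

    restrictVal⁺ : ∀ x i k (p : i + k ≤ n) →
                   v x (wordsFrom w i k p) → restrictVal v w x (lettersFrom i k p)
    restrictVal⁺ x i k p segment∈v =
      i , i + k , m≤m+n i k , p ,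
      lettersFrom-cong _ _ refl (sym (m+n∸m≡n i k)) ,
      subst (v x) (wordsFrom-cong _ _ refl (sym (m+n∸m≡n i k))) segment∈v

    ⟦⟧-transfers : ∀ t → Transfers (⟦ t ⟧ (restrictVal v w)) (⟦ t ⟧ v)
    ⟦⟧-transfers (var x) = restrictVal⁻ x
    ⟦⟧-transfers I i zero p _ = refl
    ⟦⟧-transfers (t · s) i k p (a , b , e , a∈t , b∈s) with lettersFrom-split i k p a b (sym e)
    ... | splitAt k₁ k₂ refl p₁ p₂ a≡ b≡ =
      wordsFrom w i k₁ p₁ , wordsFrom w (i + k₁) k₂ p₂ , wordsFrom-++ i k₁ k₂ p p₁ p₂ ,
      ⟦⟧-transfers t i k₁ p₁ (subst _ a≡ a∈t) , ⟦⟧-transfers s (i + k₁) k₂ p₂ (subst _ b≡ b∈s)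
    ⟦⟧-transfers (t ∪ s) i k p (inj₁ u∈t) = inj₁ (⟦⟧-transfers t i k p u∈t)
    ⟦⟧-transfers (t ∪ s) i k p (inj₂ u∈s) = inj₂ (⟦⟧-transfers s i k p u∈s)
    ⟦⟧-transfers (t ⋆) = Star-transfers (⟦⟧-transfers t)
    ⟦⟧-transfers (x ⁻) i k p u∉x segment∈v = u∉x (restrictVal⁺ x i k p segment∈v)

lemma5p3 : {V X : Set} (v : Valuation V X) (n : ℕ) (w : Fin n → List X)
    (t : Term V) (i j : ℕ) (i≤j : i ≤ j) (j≤n : j ≤ n) →
    ⟦ t ⟧ (restrictVal v w) (letters i j i≤j j≤n) → ⟦ t ⟧ v (segment w i j i≤j j≤n)
lemma5p3 v n w t i j i≤j j≤n = ⟦⟧-transfers w v t i (j ∸ i) _
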